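{- Let $n\ge2$ and for $1\le j\le n$ let $\alpha_j\in\mathbb Z$, $\beta_j\in\mathbb N$ with $\gcd(\alpha_j,\beta_j)=1$, $\beta_j\nmid\alpha_j$, $\beta_j\nmid2\alpha_j$, and $\frac{\alpha_r}{\beta_r}\pm\frac{\alpha_s}{\beta_s}\notin\mathbb Z$ for $r\ne s$. Then the set $Q_{\boldsymbol{\zeta_n}}$ is closed under the action (by Möbius transformations) of the group $\Gamma_{\boldsymbol{\zeta_n}}$.
   Context: $Q_{\boldsymbol{\zeta_n}}$ is the set of $h/k$ with $h\in\mathbb Z$, $k\in\mathbb N$, $\gcd(h,k)=1$, $\beta_j\nmid k$ for all $j$, and $\left|\frac{\alpha_j}{\beta_j}k-\left[\frac{\alpha_j}{\beta_j}k\right]\right|>\frac16$ for all $j$, where $[y]$ denotes a nearest integer to $y$. $\ell=6\,\mathrm{lcm}(\beta_1,\dots,\beta_n)^2$ if $3\nmid\beta_j$ for all $j$, and $\ell=2\,\mathrm{lcm}(\beta_1,\dots,\beta_n)^2$ if $3\mid\beta_j$ for some $j$. $\Gamma_{\boldsymbol{\zeta_n}}\subseteq\mathrm{SL}_2(\mathbb Z)$ is the group generated by $\begin{pmatrix}1&1\\0&1\end{pmatrix}$ and $\begin{pmatrix}1&0\\ \ell&1\end{pmatrix}$. -}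

module Defs where

open import Data.Nat as ℕ using (ℕ; zero; suc)
open import Data.Nat.Divisibility using (_∣?_)
open import Data.Nat.LCM using (lcm)
open import Data.Integer as ℤ using (ℤ; +_)
open import Data.Integer.Divisibility as ℤD using ()
open import Data.Rational as ℚ using (ℚ; _/_; ↥_; ↧ₙ_; ∣_∣; _<_; _≤_; _-_; _*_; _+_; 0ℚ)
open import Data.Fin using (Fin)
open import Data.Fin.Properties using (any?)
open import Data.Vec.Functional using (foldr)
open import Data.Product using (_×_; Σ)
open import Relation.Nullary using (¬_; yes; no)
open import Relation.Binary.PropositionalEquality using (_≡_; _≢_)

ℤtoℚ : ℤ → ℚ
ℤtoℚ m = m / 1

-- the rational a / b (for b ≥ 1; the value at b = 0 is a dummy and never used,
-- since the hypotheses of the theorem require every β_j ≥ 1)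
frac : ℤ → ℕ → ℚ
frac a zero    = 0ℚ
frac a (suc b) = a / suc b

IsNearestInt : ℚ → ℤ → Set
IsNearestInt y m = ∀ (m' : ℤ) → ∣ y - ℤtoℚ m ∣ ≤ ∣ y - ℤtoℚ m' ∣

lcmAll : ∀ {n} → (Fin n → ℕ) → ℕ
lcmAll β = foldr lcm 1 β

ellOf : ∀ {n} → (Fin n → ℕ) → ℕ
ellOf β with any? (λ j → 3 ∣? β j)
... | yes _ = 2 ℕ.* (lcmAll β ℕ.* lcmAll β)
... | no  _ = 6 ℕ.* (lcmAll β ℕ.* lcmAll β)

-- Membership in Q_ζ of the reduced fraction q = h/k (h = ↥ q, k = ↧ₙ q ≥ 1,
-- gcd(h,k) = 1 built into ℚ).
InQ : ∀ {n} → (Fin n → ℤ) → (Fin n → ℕ) → ℚ → Set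
InQ {n} α β q = ∀ (j : Fin n) →
  (¬ (β j Data.Nat.Divisibility.∣ ↧ₙ q)) ×
  (∀ (m : ℤ) → IsNearestInt (frac (α j ℤ.* + (↧ₙ q)) (β j)) m →
     (+ 1 / 6) < ∣ frac (α j ℤ.* + (↧ₙ q)) (β j) - ℤtoℚ m ∣)
  where import Data.Nat.Divisibility

record Mat : Set where
  constructor mat
  field
    a b c d : ℤ

_⊗_ : Mat → Mat → Mat
mat a b c d ⊗ mat a' b' c' d' =
  mat (a ℤ.* a' ℤ.+ b ℤ.* c') (a ℤ.* b' ℤ.+ b ℤ.* d')
      (c ℤ.* a' ℤ.+ d ℤ.* c') (c ℤ.* b' ℤ.+ d ℤ.* d')

I₂ : Mat
I₂ = mat (+ 1) (+ 0) (+ 0) (+ 1)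

Tm Tinv : Mat
Tm   = mat (+ 1) (+ 1) (+ 0) (+ 1)
Tinv = mat (+ 1) (ℤ.- (+ 1)) (+ 0) (+ 1)

Lm Linv : ℕ → Mat
Lm ℓ   = mat (+ 1) (+ 0) (+ ℓ) (+ 1)
Linv ℓ = mat (+ 1) (+ 0) (ℤ.- (+ ℓ)) (+ 1)

data InGen (ℓ : ℕ) : Mat → Set where
  gen-id   : InGen ℓ I₂
  gen-T    : ∀ {g} → InGen ℓ g → InGen ℓ (Tm ⊗ g)
  gen-Tinv : ∀ {g} → InGen ℓ g → InGen ℓ (Tinv ⊗ g)
  gen-L    : ∀ {g} → InGen ℓ g → InGen ℓ (Lm ℓ ⊗ g)
  gen-Linv : ∀ {g} → InGen ℓ g → InGen ℓ (Linv ℓ ⊗ g)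

MobiusImage : Mat → ℚ → ℚ → Set
MobiusImage (mat a b c d) q r =
  (ℤtoℚ c * q + ℤtoℚ d ≢ 0ℚ) × (r * (ℤtoℚ c * q + ℤtoℚ d) ≡ ℤtoℚ a * q + ℤtoℚ b)

{-# OPTIONS --safe #-}
-- Γ is generated by T^{±1} and L^{±1}, all of the shape (a b; c 1) with determinant 1 and every
-- β_j dividing c, since β_j ∣ ℓ. Such a matrix sends a reduced fraction h/k to (ah + bk)/(ch + k),
-- again reduced because the matrix is unimodular, so the new denominator is k' = |ch + k| ≡ ±k
-- (mod β_j). Hence β_j ∤ k', and α_j k'/β_j differs from ±α_j k/β_j by an integer; the distance
-- to a nearest integer is invariant under integer translations and negation.
module Submission where

open import Defs
open import Data.Nat as ℕ using (ℕ; _≤_; zero; suc)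
open import Data.Nat.GCD using (gcd)
open import Data.Nat.Coprimality using (Coprime; recompute)
import Data.Nat.Properties as ℕ
import Data.Nat.Divisibility as ℕ
open import Data.Nat.Divisibility using (_∣?_)
open import Data.Nat.LCM using (m∣lcm[m,n]; n∣lcm[m,n])
open import Data.Integer using (ℤ; +_; +[1+_]; -[1+_]; ∣_∣; _*_)
import Data.Integer as ℤ
import Data.Integer.Properties as ℤ
open import Data.Integer.Divisibility using (_∣_)
import Data.Integer.Divisibility.Signed as Signed
open import Data.Integer.Tactic.RingSolver using (solve-∀)
open import Data.Rational using (ℚ; _+_; _-_; _<_; mkℚ; ↥_; ↧_; ↧ₙ_; 0ℚ; 1ℚ; 1/_; NonZero; ≢-nonZero)
  renaming (_*_ to _·_)
import Data.Rational as ℚ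
open import Data.Rational.Properties
  using (toℚᵘ-injective; toℚᵘ-fromℚᵘ; fromℚᵘ-toℚᵘ; fromℚᵘ-cong; fromℚᵘ-injective
        ; toℚᵘ-homo-+; toℚᵘ-homo-*; toℚᵘ-homo‿-; ↧-neg; ∣-p∣≡∣p∣
        ; *-assoc; *-identityʳ; *-identityˡ; *-zeroˡ; *-inverseʳ; +-identityˡ; +-identityʳ)
open import Data.Rational.Unnormalised as ℚᵘ using (mkℚᵘ; *≡*)
import Data.Rational.Unnormalised.Properties as ℚᵘ
open import Data.Rational.Solver using (module +-*-Solver)
open import Data.Fin using (Fin; zero; suc)
open import Data.Fin.Properties using (any?)
open import Data.Product using (Σ; _×_; _,_; proj₁; proj₂)
open import Data.Sum using (inj₁; inj₂)
open import Data.Empty using (⊥-elim)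
open import Function.Base using (case_of_)
open import Relation.Nullary using (¬_; yes; no)
open import Relation.Binary.PropositionalEquality
  using (_≡_; _≢_; refl; sym; trans; cong; cong₂; subst; subst₂; module ≡-Reasoning)

open +-*-Solver using (solve; _:=_; _:+_; _:*_; :-_; _:-_)

fromℚᵘ-homo-+ : ∀ p q → ℚ.fromℚᵘ (p ℚᵘ.+ q) ≡ ℚ.fromℚᵘ p + ℚ.fromℚᵘ q
fromℚᵘ-homo-+ p q = toℚᵘ-injective (ℚᵘ.≃-trans (toℚᵘ-fromℚᵘ (p ℚᵘ.+ q))
  (ℚᵘ.≃-sym (ℚᵘ.≃-trans (toℚᵘ-homo-+ (ℚ.fromℚᵘ p) (ℚ.fromℚᵘ q))
                         (ℚᵘ.+-cong (toℚᵘ-fromℚᵘ p) (toℚᵘ-fromℚᵘ q)))))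

fromℚᵘ-homo-* : ∀ p q → ℚ.fromℚᵘ (p ℚᵘ.* q) ≡ ℚ.fromℚᵘ p · ℚ.fromℚᵘ q
fromℚᵘ-homo-* p q = toℚᵘ-injective (ℚᵘ.≃-trans (toℚᵘ-fromℚᵘ (p ℚᵘ.* q))
  (ℚᵘ.≃-sym (ℚᵘ.≃-trans (toℚᵘ-homo-* (ℚ.fromℚᵘ p) (ℚ.fromℚᵘ q))
                         (ℚᵘ.*-cong (toℚᵘ-fromℚᵘ p) (toℚᵘ-fromℚᵘ q)))))

fromℚᵘ-homo‿- : ∀ p → ℚ.fromℚᵘ (ℚᵘ.- p) ≡ ℚ.- ℚ.fromℚᵘ p
fromℚᵘ-homo‿- p = toℚᵘ-injective (ℚᵘ.≃-trans (toℚᵘ-fromℚᵘ (ℚᵘ.- p))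
  (ℚᵘ.≃-sym (ℚᵘ.≃-trans (toℚᵘ-homo‿- (ℚ.fromℚᵘ p)) (ℚᵘ.-‿cong (toℚᵘ-fromℚᵘ p)))))

-- ℤtoℚ a and frac x (suc b) are definitionally fromℚᵘ (mkℚᵘ a 0) and fromℚᵘ (mkℚᵘ x b),
-- so identities between them reduce to cross-multiplications in ℚᵘ.
ℤtoℚ-homo-+ : ∀ a b → ℤtoℚ (a ℤ.+ b) ≡ ℤtoℚ a + ℤtoℚ b
ℤtoℚ-homo-+ a b = trans (fromℚᵘ-cong {mkℚᵘ (a ℤ.+ b) 0} {mkℚᵘ a 0 ℚᵘ.+ mkℚᵘ b 0} (*≡* cross))
                        (fromℚᵘ-homo-+ (mkℚᵘ a 0) (mkℚᵘ b 0))
  where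
  cross : (a ℤ.+ b) * + 1 ≡ (a * + 1 ℤ.+ b * + 1) * + 1
  cross = cong (_* + 1) (sym (cong₂ ℤ._+_ (ℤ.*-identityʳ a) (ℤ.*-identityʳ b)))

ℤtoℚ-homo-* : ∀ a b → ℤtoℚ (a * b) ≡ ℤtoℚ a · ℤtoℚ b
ℤtoℚ-homo-* a b = fromℚᵘ-homo-* (mkℚᵘ a 0) (mkℚᵘ b 0)

ℤtoℚ-homo‿- : ∀ a → ℤtoℚ (ℤ.- a) ≡ ℚ.- ℤtoℚ a
ℤtoℚ-homo‿- a = fromℚᵘ-homo‿- (mkℚᵘ a 0)

ℤtoℚ-injective : ∀ {a b} → ℤtoℚ a ≡ ℤtoℚ b → a ≡ b
ℤtoℚ-injective {a} {b} eq with fromℚᵘ-injective {mkℚᵘ a 0} {mkℚᵘ b 0} eq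
... | *≡* a*1≡b*1 = trans (sym (ℤ.*-identityʳ a)) (trans a*1≡b*1 (ℤ.*-identityʳ b))

p·↧p≡↥p : ∀ p → p · ℤtoℚ (↧ p) ≡ ℤtoℚ (↥ p)
p·↧p≡↥p p@(mkℚ n d _) = begin
  p · ℤtoℚ (↧ p)                         ≡⟨ cong (_· ℤtoℚ (↧ p)) (sym (fromℚᵘ-toℚᵘ p)) ⟩
  ℚ.fromℚᵘ (mkℚᵘ n d) · ℤtoℚ (↧ p)       ≡⟨ sym (fromℚᵘ-homo-* (mkℚᵘ n d) (mkℚᵘ (↧ p) 0)) ⟩
  ℚ.fromℚᵘ (mkℚᵘ n d ℚᵘ.* mkℚᵘ (↧ p) 0)  ≡⟨ fromℚᵘ-cong {mkℚᵘ n d ℚᵘ.* mkℚᵘ (↧ p) 0} {mkℚᵘ n 0}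
                                                          (*≡* n*↧p*1≡n*↧p) ⟩
  ℤtoℚ n                                 ∎
  where
  open ≡-Reasoning
  n*↧p*1≡n*↧p : (n * + suc d) * + 1 ≡ n * + suc (d ℕ.* 1)
  n*↧p*1≡n*↧p rewrite ℕ.*-identityʳ d = ℤ.*-identityʳ (n * + suc d)

frac-+-multiple : ∀ x t b → frac (x ℤ.+ t * + suc b) (suc b) ≡ frac x (suc b) + ℤtoℚ t
frac-+-multiple x t b = trans (fromℚᵘ-cong {mkℚᵘ (x ℤ.+ t * + suc b) b} {mkℚᵘ x b ℚᵘ.+ mkℚᵘ t 0} (*≡* cross))
                              (fromℚᵘ-homo-+ (mkℚᵘ x b) (mkℚᵘ t 0))
  where
  cross : (x ℤ.+ t * + suc b) * + suc (b ℕ.* 1) ≡ (x * + 1 ℤ.+ t * + suc b) * + suc b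
  cross rewrite ℕ.*-identityʳ b = cong (λ y → (y ℤ.+ t * + suc b) * + suc b) (sym (ℤ.*-identityʳ x))

frac-neg : ∀ x b → frac (ℤ.- x) (suc b) ≡ ℚ.- frac x (suc b)
frac-neg x b = fromℚᵘ-homo‿- (mkℚᵘ x b)

*-cancelʳ-≡ : ∀ p q r .{{_ : NonZero r}} → p · r ≡ q · r → p ≡ q
*-cancelʳ-≡ p q r p·r≡q·r = begin
  p                 ≡⟨ sym (*-identityʳ p) ⟩
  p · 1ℚ            ≡⟨ cong (p ·_) (sym (*-inverseʳ r)) ⟩
  p · (r · 1/ r)    ≡⟨ sym (*-assoc p r (1/ r)) ⟩
  p · r · 1/ r      ≡⟨ cong (_· 1/ r) p·r≡q·r ⟩
  q · r · 1/ r      ≡⟨ *-assoc q r (1/ r) ⟩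
  q · (r · 1/ r)    ≡⟨ cong (q ·_) (*-inverseʳ r) ⟩
  q · 1ℚ            ≡⟨ *-identityʳ q ⟩
  q                 ∎
  where open ≡-Reasoning

p≢0∧q≢0⇒p·q≢0 : ∀ {p q} → p ≢ 0ℚ → q ≢ 0ℚ → p · q ≢ 0ℚ
p≢0∧q≢0⇒p·q≢0 {p} {q} p≢0 q≢0 p·q≡0 =
  p≢0 (*-cancelʳ-≡ p 0ℚ q {{≢-nonZero q≢0}} (trans p·q≡0 (sym (*-zeroˡ q))))

ℤtoℚ-homo-*+* : ∀ x y z w → ℤtoℚ (x * y ℤ.+ z * w) ≡ ℤtoℚ x · ℤtoℚ y + ℤtoℚ z · ℤtoℚ w
ℤtoℚ-homo-*+* x y z w =
  trans (ℤtoℚ-homo-+ (x * y) (z * w)) (cong₂ _+_ (ℤtoℚ-homo-* x y) (ℤtoℚ-homo-* z w))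

MobiusImage-I₂ : ∀ q → MobiusImage I₂ q q
MobiusImage-I₂ q = (λ den≡0 → 1≢0 (trans (sym den≡1) den≡0)) , q·den≡num
  where
  open ≡-Reasoning
  den≡1 : ℤtoℚ (+ 0) · q + ℤtoℚ (+ 1) ≡ 1ℚ
  den≡1 = trans (cong (_+ 1ℚ) (*-zeroˡ q)) (+-identityˡ 1ℚ)
  1≢0 : 1ℚ ≢ 0ℚ
  1≢0 ()
  q·den≡num : q · (ℤtoℚ (+ 0) · q + ℤtoℚ (+ 1)) ≡ ℤtoℚ (+ 1) · q + ℤtoℚ (+ 0)
  q·den≡num = begin
    q · (ℤtoℚ (+ 0) · q + ℤtoℚ (+ 1)) ≡⟨ cong (q ·_) den≡1 ⟩
    q · 1ℚ                            ≡⟨ *-identityʳ q ⟩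
    q                                 ≡⟨ sym (*-identityˡ q) ⟩
    1ℚ · q                            ≡⟨ sym (+-identityʳ (1ℚ · q)) ⟩
    1ℚ · q + 0ℚ                       ∎

MobiusImage-⊗ : ∀ g G {q r s} → MobiusImage g q r → MobiusImage G r s → MobiusImage (G ⊗ g) q s
MobiusImage-⊗ (mat a b c d) (mat a' b' c' d') {q} {r} {s} (den≢0 , r·den≡num) (den'≢0 , s·den'≡num') =
  (λ den″≡0 → p≢0∧q≢0⇒p·q≢0 den'≢0 den≢0 (trans (sym (row c' d')) den″≡0)) , s·den″≡num″
  where
  open ≡-Reasoning
  den : ℚ
  den = ℤtoℚ c · q + ℤtoℚ d
  -- Row (x y) of G applied to g (q, 1)ᵀ = den · (r, 1)ᵀ.
  row : ∀ x y → ℤtoℚ (x * a ℤ.+ y * c) · q + ℤtoℚ (x * b ℤ.+ y * d) ≡ (ℤtoℚ x · r + ℤtoℚ y) · den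
  row x y = begin
    ℤtoℚ (x * a ℤ.+ y * c) · q + ℤtoℚ (x * b ℤ.+ y * d)
      ≡⟨ cong₂ (λ u v → u · q + v) (ℤtoℚ-homo-*+* x a y c) (ℤtoℚ-homo-*+* x b y d) ⟩
    (X · A + Y · C) · q + (X · B + Y · D)
      ≡⟨ solve 7 (λ X A Y C q B D → (X :* A :+ Y :* C) :* q :+ (X :* B :+ Y :* D)
                                 := X :* (A :* q :+ B) :+ Y :* (C :* q :+ D)) refl X A Y C q B D ⟩
    X · (A · q + B) + Y · den
      ≡⟨ cong (λ u → X · u + Y · den) (sym r·den≡num) ⟩
    X · (r · den) + Y · den
      ≡⟨ solve 4 (λ X r Y den → X :* (r :* den) :+ Y :* den := (X :* r :+ Y) :* den) refl X r Y den ⟩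
    (X · r + Y) · den ∎
    where
    X = ℤtoℚ x
    Y = ℤtoℚ y
    A = ℤtoℚ a
    B = ℤtoℚ b
    C = ℤtoℚ c
    D = ℤtoℚ d
  s·den″≡num″ : s · (ℤtoℚ (c' * a ℤ.+ d' * c) · q + ℤtoℚ (c' * b ℤ.+ d' * d))
              ≡ ℤtoℚ (a' * a ℤ.+ b' * c) · q + ℤtoℚ (a' * b ℤ.+ b' * d)
  s·den″≡num″ = begin
    s · (ℤtoℚ (c' * a ℤ.+ d' * c) · q + ℤtoℚ (c' * b ℤ.+ d' * d)) ≡⟨ cong (s ·_) (row c' d') ⟩
    s · ((ℤtoℚ c' · r + ℤtoℚ d') · den)                           ≡⟨ sym (*-assoc s _ den) ⟩
    s · (ℤtoℚ c' · r + ℤtoℚ d') · den                             ≡⟨ cong (_· den) s·den'≡num' ⟩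
    (ℤtoℚ a' · r + ℤtoℚ b') · den                                 ≡⟨ sym (row a' b') ⟩
    ℤtoℚ (a' * a ℤ.+ b' * c) · q + ℤtoℚ (a' * b ℤ.+ b' * d)        ∎

coprime-unimodular : ∀ {a b c d} h k → a * d ℤ.- b * c ≡ + 1 → Coprime ∣ h ∣ ∣ k ∣ →
                     Coprime ∣ a * h ℤ.+ b * k ∣ ∣ c * h ℤ.+ d * k ∣
coprime-unimodular {a} {b} {c} {d} h k det coprime {i} (i∣M , i∣N) = coprime
  ( Signed.∣⇒∣ᵤ (dividing h (eliminate-k a b c d h k) (Signed.∣m∣n⇒∣m-n (*∣ d i∣M) (*∣ b i∣N)))
  , Signed.∣⇒∣ᵤ (dividing k (eliminate-h a b c d h k) (Signed.∣m∣n⇒∣m-n (*∣ a i∣N) (*∣ c i∣M))))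
  where
  *∣ : ∀ x {y} → + i ∣ y → + i Signed.∣ x * y
  *∣ x i∣y = Signed.∣n⇒∣m*n x (Signed.∣ᵤ⇒∣ i∣y)
  dividing : ∀ x {y} → y ≡ (a * d ℤ.- b * c) * x → + i Signed.∣ y → + i Signed.∣ x
  dividing x y≡det·x =
    subst (+ i Signed.∣_) (trans y≡det·x (trans (cong (_* x) det) (ℤ.*-identityˡ x)))
  eliminate-k : ∀ a b c d h k →
    d * (a * h ℤ.+ b * k) ℤ.- b * (c * h ℤ.+ d * k) ≡ (a * d ℤ.- b * c) * h
  eliminate-k = solve-∀
  eliminate-h : ∀ a b c d h k →
    a * (c * h ℤ.+ d * k) ℤ.- c * (a * h ℤ.+ b * k) ≡ (a * d ℤ.- b * c) * k
  eliminate-h = solve-∀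

coprime-fraction : ∀ M N → Coprime ∣ M ∣ ∣ N ∣ → N ≢ + 0 →
                   Σ ℚ λ r → r · ℤtoℚ N ≡ ℤtoℚ M × ↧ₙ r ≡ ∣ N ∣
coprime-fraction M (+ zero)   coprime N≢0 = ⊥-elim (N≢0 refl)
coprime-fraction M +[1+ n ]   coprime N≢0 = mkℚ M n coprime , p·↧p≡↥p (mkℚ M n coprime) , refl
coprime-fraction M -[1+ n ]   coprime N≢0 = ℚ.- r , -r·-N≡M , cong ∣_∣ (↧-neg r)
  where
  r = mkℚ M n coprime
  -r·-N≡M : ℚ.- r · ℤtoℚ -[1+ n ] ≡ ℤtoℚ M
  -r·-N≡M = begin
    ℚ.- r · ℤtoℚ (ℤ.- +[1+ n ])      ≡⟨ cong (ℚ.- r ·_) (ℤtoℚ-homo‿- +[1+ n ]) ⟩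
    ℚ.- r · ℚ.- ℤtoℚ +[1+ n ]        ≡⟨ solve 2 (λ r N → (:- r) :* (:- N) := r :* N) refl r (ℤtoℚ +[1+ n ]) ⟩
    r · ℤtoℚ +[1+ n ]                ≡⟨ p·↧p≡↥p r ⟩
    ℤtoℚ M                           ∎
    where open ≡-Reasoning

[x·q+y]·↧q≡x·↥q+y·↧q : ∀ x y q → (ℤtoℚ x · q + ℤtoℚ y) · ℤtoℚ (↧ q) ≡ ℤtoℚ (x * ↥ q ℤ.+ y * ↧ q)
[x·q+y]·↧q≡x·↥q+y·↧q x y q = begin
  (X · q + Y) · K
    ≡⟨ solve 4 (λ X q Y K → (X :* q :+ Y) :* K := X :* (q :* K) :+ Y :* K) refl X q Y K ⟩
  X · (q · K) + Y · K       ≡⟨ cong (λ u → X · u + Y · K) (p·↧p≡↥p q) ⟩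
  X · ℤtoℚ (↥ q) + Y · K    ≡⟨ sym (ℤtoℚ-homo-*+* x (↥ q) y (↧ q)) ⟩
  ℤtoℚ (x * ↥ q ℤ.+ y * ↧ q) ∎
  where
  open ≡-Reasoning
  X = ℤtoℚ x
  Y = ℤtoℚ y
  K = ℤtoℚ (↧ q)

MobiusImage-unimodular : ∀ {a b c d} q → a * d ℤ.- b * c ≡ + 1 → c * ↥ q ℤ.+ d * ↧ q ≢ + 0 →
                         Σ ℚ λ r → MobiusImage (mat a b c d) q r × ↧ₙ r ≡ ∣ c * ↥ q ℤ.+ d * ↧ q ∣
MobiusImage-unimodular {a} {b} {c} {d} q@(mkℚ h k-1 coprime) det N≢0 =
  r , (den≢0 , r·den≡num) , ↧r≡∣N∣
  where
  open ≡-Reasoning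
  k = ↧ q
  M = a * h ℤ.+ b * k
  N = c * h ℤ.+ d * k
  fraction : Σ ℚ λ r → r · ℤtoℚ N ≡ ℤtoℚ M × ↧ₙ r ≡ ∣ N ∣
  fraction = coprime-fraction M N (coprime-unimodular {a} {b} {c} {d} h k det (recompute coprime)) N≢0
  r = proj₁ fraction
  ↧r≡∣N∣ = proj₂ (proj₂ fraction)
  den≢0 : ℤtoℚ c · q + ℤtoℚ d ≢ 0ℚ
  den≢0 den≡0 = N≢0 (ℤtoℚ-injective (begin
    ℤtoℚ N                            ≡⟨ sym ([x·q+y]·↧q≡x·↥q+y·↧q c d q) ⟩
    (ℤtoℚ c · q + ℤtoℚ d) · ℤtoℚ k    ≡⟨ cong (_· ℤtoℚ k) den≡0 ⟩
    0ℚ · ℤtoℚ k                       ≡⟨ *-zeroˡ (ℤtoℚ k) ⟩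
    ℤtoℚ (+ 0)                        ∎))
  k≢0 : ℤtoℚ k ≢ 0ℚ
  k≢0 k≡0 = case ℤtoℚ-injective {k} {+ 0} k≡0 of λ ()
  r·den≡num : r · (ℤtoℚ c · q + ℤtoℚ d) ≡ ℤtoℚ a · q + ℤtoℚ b
  r·den≡num = *-cancelʳ-≡ _ _ (ℤtoℚ k) {{≢-nonZero k≢0}} (begin
    r · (ℤtoℚ c · q + ℤtoℚ d) · ℤtoℚ k    ≡⟨ *-assoc r _ (ℤtoℚ k) ⟩
    r · ((ℤtoℚ c · q + ℤtoℚ d) · ℤtoℚ k)  ≡⟨ cong (r ·_) ([x·q+y]·↧q≡x·↥q+y·↧q c d q) ⟩
    r · ℤtoℚ N                            ≡⟨ proj₁ (proj₂ fraction) ⟩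
    ℤtoℚ M                                ≡⟨ sym ([x·q+y]·↧q≡x·↥q+y·↧q a b q) ⟩
    (ℤtoℚ a · q + ℤtoℚ b) · ℤtoℚ k        ∎)

FarFromℤ : ℚ → ℚ → Set
FarFromℤ δ y = ∀ m → IsNearestInt y m → δ < ℚ.∣ y - ℤtoℚ m ∣

FarFromℤ-transport : ∀ {δ y y'} (f g : ℤ → ℤ) → (∀ m → f (g m) ≡ m) →
                     (∀ m → ℚ.∣ y' - ℤtoℚ m ∣ ≡ ℚ.∣ y - ℤtoℚ (f m) ∣) →
                     FarFromℤ δ y → FarFromℤ δ y'
FarFromℤ-transport {δ} {y} f g f∘g≗id dist far m m-nearest =
  subst (δ <_) (sym (dist m)) (far (f m) f[m]-nearest)
  where
  f[m]-nearest : IsNearestInt y (f m)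
  f[m]-nearest m' = subst₂ ℚ._≤_ (dist m)
    (trans (dist (g m')) (cong (λ z → ℚ.∣ y - ℤtoℚ z ∣) (f∘g≗id m')))
    (m-nearest (g m'))

FarFromℤ-+ℤ : ∀ {δ} y t → FarFromℤ δ y → FarFromℤ δ (y + ℤtoℚ t)
FarFromℤ-+ℤ y t = FarFromℤ-transport {y = y} {y + ℤtoℚ t} (ℤ._- t) (ℤ._+ t) (λ m → m+t-t≡m m t)
                                     (λ m → cong ℚ.∣_∣ (shift m))
  where
  open ≡-Reasoning
  shift : ∀ m → y + ℤtoℚ t - ℤtoℚ m ≡ y - ℤtoℚ (m ℤ.- t)
  shift m = begin
    y + ℤtoℚ t - ℤtoℚ m          ≡⟨ solve 3 (λ y T M → y :+ T :- M := y :- (M :+ :- T)) refl y (ℤtoℚ t) (ℤtoℚ m) ⟩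
    y - (ℤtoℚ m + ℚ.- ℤtoℚ t)    ≡⟨ cong (λ z → y - (ℤtoℚ m + z)) (sym (ℤtoℚ-homo‿- t)) ⟩
    y - (ℤtoℚ m + ℤtoℚ (ℤ.- t))  ≡⟨ cong (y -_) (sym (ℤtoℚ-homo-+ m (ℤ.- t))) ⟩
    y - ℤtoℚ (m ℤ.- t)           ∎
  m+t-t≡m : ∀ m t → m ℤ.+ t ℤ.- t ≡ m
  m+t-t≡m = solve-∀

FarFromℤ-neg : ∀ {δ} y → FarFromℤ δ y → FarFromℤ δ (ℚ.- y)
FarFromℤ-neg y = FarFromℤ-transport {y = y} {ℚ.- y} ℤ.-_ ℤ.-_ ℤ.neg-involutive reflect
  where
  open ≡-Reasoning
  reflect : ∀ m → ℚ.∣ ℚ.- y - ℤtoℚ m ∣ ≡ ℚ.∣ y - ℤtoℚ (ℤ.- m) ∣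
  reflect m = begin
    ℚ.∣ ℚ.- y - ℤtoℚ m ∣        ≡⟨ cong ℚ.∣_∣ (solve 2 (λ y M → :- y :- M := :- (y :- :- M)) refl y (ℤtoℚ m)) ⟩
    ℚ.∣ ℚ.- (y - ℚ.- ℤtoℚ m) ∣  ≡⟨ ∣-p∣≡∣p∣ (y - ℚ.- ℤtoℚ m) ⟩
    ℚ.∣ y - ℚ.- ℤtoℚ m ∣        ≡⟨ cong (λ z → ℚ.∣ y - z ∣) (sym (ℤtoℚ-homo‿- m)) ⟩
    ℚ.∣ y - ℤtoℚ (ℤ.- m) ∣      ∎

frac-*-+multiple : ∀ a t k b →
                   frac (a * (t * + suc b ℤ.+ k)) (suc b) ≡ frac (a * k) (suc b) + ℤtoℚ (a * t)
frac-*-+multiple a t k b =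
  trans (cong (λ z → frac z (suc b)) (distribute a t (+ suc b) k)) (frac-+-multiple (a * k) (a * t) b)
  where
  distribute : ∀ a t b k → a * (t * b ℤ.+ k) ≡ a * k ℤ.+ a * t * b
  distribute = solve-∀

FarFromℤ-frac-+multiple : ∀ {δ} a b e k → + b ∣ e →
                          FarFromℤ δ (frac (a * k) b) → FarFromℤ δ (frac (a * + ∣ e ℤ.+ k ∣) b)
FarFromℤ-frac-+multiple a zero e k _ far = far
FarFromℤ-frac-+multiple {δ} a (suc b) e k b∣e far with Signed.∣ᵤ⇒∣ {+ suc b} {e} b∣e
... | Signed.divides t refl with ℤ.+∣i∣≡i⊎+∣i∣≡-i (t * + suc b ℤ.+ k)
...   | inj₁ +∣N∣≡N = subst (FarFromℤ δ) (sym (begin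
  frac (a * + ∣ N ∣) (suc b)             ≡⟨ cong (λ z → frac (a * z) (suc b)) +∣N∣≡N ⟩
  frac (a * N) (suc b)                   ≡⟨ frac-*-+multiple a t k b ⟩
  frac (a * k) (suc b) + ℤtoℚ (a * t)    ∎))
  (FarFromℤ-+ℤ (frac (a * k) (suc b)) (a * t) far)
  where
  open ≡-Reasoning
  N = t * + suc b ℤ.+ k
...   | inj₂ +∣N∣≡-N = subst (FarFromℤ δ) (sym (begin
  frac (a * + ∣ N ∣) (suc b)                   ≡⟨ cong (λ z → frac (a * z) (suc b)) +∣N∣≡-N ⟩
  frac (a * ℤ.- N) (suc b)                     ≡⟨ cong (λ z → frac z (suc b)) (sym (ℤ.neg-distribʳ-* a N)) ⟩
  frac (ℤ.- (a * N)) (suc b)                   ≡⟨ frac-neg (a * N) b ⟩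
  ℚ.- frac (a * N) (suc b)                     ≡⟨ cong ℚ.-_ (frac-*-+multiple a t k b) ⟩
  ℚ.- (frac (a * k) (suc b) + ℤtoℚ (a * t))    ∎))
  (FarFromℤ-neg (frac (a * k) (suc b) + ℤtoℚ (a * t)) (FarFromℤ-+ℤ (frac (a * k) (suc b)) (a * t) far))
  where
  open ≡-Reasoning
  N = t * + suc b ℤ.+ k

∤-+multiple : ∀ b e k → + b ∣ e → ¬ + b ∣ k → ¬ + b ∣ e ℤ.+ k
∤-+multiple b e k b∣e b∤k b∣e+k =
  b∤k (Signed.∣⇒∣ᵤ (Signed.∣m+n∣m⇒∣n (Signed.∣ᵤ⇒∣ {+ b} {e ℤ.+ k} b∣e+k) (Signed.∣ᵤ⇒∣ {+ b} {e} b∣e)))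

InQ-+multiple : ∀ {n} (α : Fin n → ℤ) (β : Fin n → ℕ) {q r} e → (∀ j → + β j ∣ e) →
                InQ α β q → ↧ₙ r ≡ ∣ e ℤ.+ ↧ q ∣ → InQ α β r
InQ-+multiple α β {q} e β∣e q∈Q ↧r≡∣e+↧q∣ j =
  subst (λ k → ¬ β j ℕ.∣ k × FarFromℤ (+ 1 ℚ./ 6) (frac (α j * + k) (β j))) (sym ↧r≡∣e+↧q∣)
        ( ∤-+multiple (β j) e (↧ q) (β∣e j) (proj₁ (q∈Q j))
        , FarFromℤ-frac-+multiple (α j) (β j) e (↧ q) (β∣e j) (proj₂ (q∈Q j)))

β∣lcmAll : ∀ {n} (β : Fin n → ℕ) j → β j ℕ.∣ lcmAll β
β∣lcmAll β zero    = m∣lcm[m,n] (β zero) _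
β∣lcmAll β (suc j) = ℕ.∣-trans (β∣lcmAll (λ i → β (suc i)) j) (n∣lcm[m,n] (β zero) _)

β∣ellOf : ∀ {n} (β : Fin n → ℕ) j → β j ℕ.∣ ellOf β
β∣ellOf β j with any? (λ j → 3 ∣? β j)
... | yes _ = ℕ.∣-trans (β∣lcmAll β j) (ℕ.∣-trans (ℕ.m∣m*n _) (ℕ.n∣m*n 2))
... | no  _ = ℕ.∣-trans (β∣lcmAll β j) (ℕ.∣-trans (ℕ.m∣m*n _) (ℕ.n∣m*n 6))

InQ-image : ∀ {n} (α : Fin n → ℤ) (β : Fin n → ℕ) {a b c} → Fin n →
            a * + 1 ℤ.- b * c ≡ + 1 → (∀ j → + β j ∣ c) →
            ∀ {q} → InQ α β q → Σ ℚ λ r → MobiusImage (mat a b c (+ 1)) q r × InQ α β r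
InQ-image α β {a} {b} {c} j₀ det β∣c {q} q∈Q =
  r , q↦r , InQ-+multiple α β {q} {r} (c * ↥ q) β∣c*↥q q∈Q ↧r≡∣c↥q+↧q∣
  where
  β∣c*↥q : ∀ j → + β j ∣ c * ↥ q
  β∣c*↥q j = Signed.∣⇒∣ᵤ (Signed.∣m⇒∣m*n (↥ q) (Signed.∣ᵤ⇒∣ {+ β j} {c} (β∣c j)))
  N≢0 : c * ↥ q ℤ.+ + 1 * ↧ q ≢ + 0
  N≢0 N≡0 = ∤-+multiple (β j₀) (c * ↥ q) (↧ q) (β∣c*↥q j₀) (proj₁ (q∈Q j₀))
    (subst (λ z → + β j₀ ∣ c * ↥ q ℤ.+ z) (ℤ.*-identityˡ (↧ q))
           (subst (+ β j₀ ∣_) (sym N≡0) (β j₀ ℕ.∣0)))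
  image : Σ ℚ λ r → MobiusImage (mat a b c (+ 1)) q r × ↧ₙ r ≡ ∣ c * ↥ q ℤ.+ + 1 * ↧ q ∣
  image = MobiusImage-unimodular {a} {b} {c} {+ 1} q det N≢0
  r = proj₁ image
  q↦r = proj₁ (proj₂ image)
  ↧r≡∣c↥q+↧q∣ : ↧ₙ r ≡ ∣ c * ↥ q ℤ.+ ↧ q ∣
  ↧r≡∣c↥q+↧q∣ = trans (proj₂ (proj₂ image)) (cong (λ z → ∣ c * ↥ q ℤ.+ z ∣) (ℤ.*-identityˡ (↧ q)))

-- Only the existence of an index j₀ is used (it rules out a vanishing denominator c q + 1).
lemma3p3 : (n : ℕ) → 2 ≤ n → (α : Fin n → ℤ) → (β : Fin n → ℕ) →
    (∀ j → 1 ≤ β j) →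
    (∀ j → gcd ∣ α j ∣ (β j) ≡ 1) →
    (∀ j → ¬ ((+ β j) ∣ α j)) →
    (∀ j → ¬ ((+ β j) ∣ ((+ 2) * α j))) →
    (∀ r s → r ≢ s → ∀ (m : ℤ) →
        ¬ (frac (α r) (β r) + frac (α s) (β s) ≡ ℤtoℚ m) ×
        ¬ (frac (α r) (β r) - frac (α s) (β s) ≡ ℤtoℚ m)) →
    ∀ (γ : Mat) → InGen (ellOf β) γ →
    ∀ (q : ℚ) → InQ α β q →
    Σ ℚ (λ r → MobiusImage γ q r × InQ α β r)
lemma3p3 (suc n) _ α β _ _ _ _ _ γ γ∈Γ q q∈Q = image γ∈Γ
  where
  Image : Mat → Set
  Image g = Σ ℚ λ r → MobiusImage g q r × InQ α β r
  extend : ∀ g a b c → a * + 1 ℤ.- b * c ≡ + 1 → (∀ j → + β j ∣ c) →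
           Image g → Image (mat a b c (+ 1) ⊗ g)
  extend g a b c det β∣c (r , g:q↦r , r∈Q) =
    let s , G:r↦s , s∈Q = InQ-image α β {a} {b} {c} zero det β∣c {r} r∈Q
    in s , MobiusImage-⊗ g (mat a b c (+ 1)) {q} {r} {s} g:q↦r G:r↦s , s∈Q
  image : ∀ {g} → InGen (ellOf β) g → Image g
  image gen-id           = q , MobiusImage-I₂ q , q∈Q
  image (gen-T {g} w)    = extend g (+ 1) (+ 1) (+ 0) refl (λ j → β j ℕ.∣0) (image w)
  image (gen-Tinv {g} w) = extend g (+ 1) (ℤ.- + 1) (+ 0) refl (λ j → β j ℕ.∣0) (image w)
  image (gen-L {g} w)    = extend g (+ 1) (+ 0) (+ ellOf β) refl (β∣ellOf β) (image w)
  image (gen-Linv {g} w) = extend g (+ 1) (+ 0) (ℤ.- + ellOf β) refl β∣-ℓ (image w)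
    where
    β∣-ℓ : ∀ j → + β j ∣ ℤ.- + ellOf β
    β∣-ℓ j = subst (β j ℕ.∣_) (sym (ℤ.∣-i∣≡∣i∣ (+ ellOf β))) (β∣ellOf β j)
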